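{- Let $d$ be a nonnegative integer and let $H$ be a multigraph of even order with $\Delta(H) \le d+1$, exactly $r$ vertices of degree $d+1$, and $d+1 < \Gamma(H) \le d+2$. Let $S\subseteq V(H)$ with $|S|$ odd, $|S|\ge 3$, such that $\langle S\rangle$ is $(d+1)$-overfull in $H$ and $\mathrm{sl}(\langle S\rangle, d+1)$ is minimum among all $(d+1)$-overfull induced odd-order subgraphs of $H$ with at least 3 vertices. Let $S^c = V(H)\setminus S$. Then $\Delta(H_S)\le d+1$, $\Gamma(H_S)\le d+2$, and $H_S$ has at most $r$ vertices of degree $d+1$; similarly $\Delta(H_{S^c})\le d+1$, $\Gamma(H_{S^c})\le d+2$, and $H_{S^c}$ has at most $r$ vertices of degree $d+1$ (each $\Gamma$-inequality whenever the multigraph in question has at least 3 vertices).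
   Context: Multigraphs are finite and loopless, with parallel edges allowed. $\langle S\rangle$ is the induced subgraph on $S$. For a multigraph $H$ of odd order $\ge 3$, $t(H)=2e(H)/(n(H)-1)$. For a multigraph with at least 3 vertices, $\Gamma(H) = \max\{t(\langle S\rangle): |S|\text{ odd},\ |S|\ge 3\}$ (undefined for fewer than 3 vertices). For an integer $k$, an odd-order subgraph with at least 3 vertices is $k$-overfull if $t>k$; its $k$-slack is $\mathrm{sl}(H,k) = (k+1)(n(H)-1)/2 - e(H)$. Shrinking: for a nonempty proper subset $S$ of $V(H)$, $H_S$ has vertex set $(V(H)\setminus S)\cup\{s\}$ with $s$ new; its edges are those of $H$ with both ends outside $S$, plus, for each $u\notin S$, as many $u$–$s$ edges as there are edges of $H$ joining $u$ to $S$. -}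

module Defs where

open import Data.Bool using (Bool; true; false; if_then_else_)
open import Data.Nat using (ℕ; zero; suc; _+_; _*_; _∸_; _≤_; _<_; _≡ᵇ_; _<ᵇ_; _/_; _%_)
open import Data.Fin using (Fin; zero; suc; toℕ)
open import Data.Vec using (Vec; []; _∷_; lookup)
open import Data.Fin.Subset using (Subset; ∁)
open import Data.Integer using (ℤ; +_; _-_)
import Data.Integer as ℤ
open import Data.Rational.Unnormalised using (ℚᵘ; mkℚᵘ)
import Data.Rational.Unnormalised as Q
open import Data.Product using (Σ; _×_; ∃-syntax)
open import Relation.Binary.PropositionalEquality using (_≡_)

sumFin : (n : ℕ) → (Fin n → ℕ) → ℕ
sumFin zero    f = 0
sumFin (suc n) f = f zero + sumFin n (λ i → f (suc i))

record Multigraph (n : ℕ) : Set where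
  field
    mult     : Fin n → Fin n → ℕ
    sym      : ∀ i j → mult i j ≡ mult j i
    loopless : ∀ i → mult i i ≡ 0
open Multigraph public

[_∈_] : ∀ {n} → Fin n → Subset n → ℕ
[ i ∈ S ] = if lookup S i then 1 else 0

size : ∀ {n} → Subset n → ℕ
size []          = 0
size (true ∷ S)  = suc (size S)
size (false ∷ S) = size S

elems : ∀ {n} (S : Subset n) → Fin (size S) → Fin n
elems (true ∷ S)  zero    = zero
elems (true ∷ S)  (suc i) = suc (elems S i)
elems (false ∷ S) i       = suc (elems S i)

deg : ∀ {n} → Multigraph n → Fin n → ℕ
deg {n} H v = sumFin n (λ u → mult H v u)

MaxDegLe : ∀ {n} → Multigraph n → ℕ → Set
MaxDegLe H k = ∀ v → deg H v ≤ k

numDeg : ∀ {n} → Multigraph n → ℕ → ℕ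
numDeg {n} H k = sumFin n (λ v → if deg H v ≡ᵇ k then 1 else 0)

eInd : ∀ {n} → Multigraph n → Subset n → ℕ
eInd {n} H S = sumFin n (λ i → sumFin n (λ j →
  [ i ∈ S ] * [ j ∈ S ] * (if toℕ i <ᵇ toℕ j then mult H i j else 0)))

OddBig : ∀ {n} → Subset n → Set
OddBig S = (size S % 2 ≡ 1) × (3 ≤ size S)

-- t(⟨S⟩) = 2 e(⟨S⟩) / (|S| - 1)   (as an unnormalised rational; mkℚᵘ a b = a/(b+1),
-- so the denominator is |S| ∸ 1 whenever |S| ≥ 3)
t : ∀ {n} → Multigraph n → Subset n → ℚᵘ
t H S = mkℚᵘ (+ (2 * eInd H S)) (size S ∸ 2)

ℕtoℚ : ℕ → ℚᵘ
ℕtoℚ k = mkℚᵘ (+ k) 0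

Overfull : ∀ {n} → Multigraph n → ℕ → Subset n → Set
Overfull H k S = OddBig S × (ℕtoℚ k Q.< t H S)

-- sl(⟨S⟩, k) = (k+1)(|S|-1)/2 - e(⟨S⟩)   (|S| odd, so (|S|-1)/2 is exact)
slack : ∀ {n} → Multigraph n → Subset n → ℕ → ℤ
slack H S k = + ((k + 1) * ((size S ∸ 1) / 2)) - + eInd H S

-- Γ(H) = max { t(⟨S⟩) : |S| odd, |S| ≥ 3 }.  Bounds on this (finite) maximum:
-- Γ(H) ≤ q
GammaLe : ∀ {n} → Multigraph n → ℚᵘ → Set
GammaLe H q = ∀ S → OddBig S → t H S Q.≤ q

GammaGt : ∀ {n} → Multigraph n → ℚᵘ → Set
GammaGt H q = ∃[ S ] (OddBig S × (q Q.< t H S))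

-- Shrinking S to a new vertex s.  H_S has vertex set Fin (1 + |V ∖ S|):
-- vertex zero is the new vertex s, vertex (suc i) is the i-th vertex of V ∖ S.
-- Number of edges of H joining u to S:
toSet : ∀ {n} → Multigraph n → Subset n → Fin n → ℕ
toSet {n} H S u = sumFin n (λ w → [ w ∈ S ] * mult H u w)

shrinkMult : ∀ {n} (H : Multigraph n) (S : Subset n) →
  Fin (suc (size (∁ S))) → Fin (suc (size (∁ S))) → ℕ
shrinkMult H S zero    zero    = 0
shrinkMult H S zero    (suc j) = toSet H S (elems (∁ S) j)
shrinkMult H S (suc i) zero    = toSet H S (elems (∁ S) i)
shrinkMult H S (suc i) (suc j) = mult H (elems (∁ S) i) (elems (∁ S) j)

shrinkSym : ∀ {n} (H : Multigraph n) (S : Subset n) i j →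
  shrinkMult H S i j ≡ shrinkMult H S j i
shrinkSym H S zero    zero    = _≡_.refl
shrinkSym H S zero    (suc j) = _≡_.refl
shrinkSym H S (suc i) zero    = _≡_.refl
shrinkSym H S (suc i) (suc j) = sym H _ _

shrinkLoop : ∀ {n} (H : Multigraph n) (S : Subset n) i → shrinkMult H S i i ≡ 0
shrinkLoop H S zero    = _≡_.refl
shrinkLoop H S (suc i) = loopless H _

shrink : ∀ {n} (H : Multigraph n) (S : Subset n) → Multigraph (suc (size (∁ S)))
shrink H S = record { mult = shrinkMult H S ; sym = shrinkSym H S ; loopless = shrinkLoop H S }

-- Write k = d + 1 and ∂S = e(S, Sᶜ).  Since ⟨S⟩ is k-overfull and every degree is at most k,
-- ∂S = Σ_{v ∈ S} deg v − 2e(S) ≤ k|S| − 2e(S) < k, so the new vertex of either shrinking has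
-- degree below k while all other degrees are unchanged.  An odd set of a shrinking that avoids
-- the new vertex is an odd set of H.  An odd set {s} ∪ T (T even) of H_S that were
-- (k+1)-overfull would make T ∪ S a k-overfull set of smaller slack than S.  For {s} ∪ T in
-- H_{Sᶜ} (T ⊆ S even, R = S ∖ T) minimality of S, or sparseness of R when R is not overfull,
-- gives 2e(S) ≥ k|T| + 2e(R); combined with the degree bound on T this caps 2e({s} ∪ T) at
-- k|T|.

module Submission where

open import Defs hiding (sym)
open import Data.Bool using (true; false; if_then_else_; T)
open import Data.Empty using (⊥-elim)
open import Data.Fin using (Fin; zero; suc; toℕ)
import Data.Fin.Properties as Fin
open import Data.Fin.Subset using (Subset; ∁; ⊤; _∪_)
open import Data.Integer using (ℤ; +≤+; +<+)
import Data.Integer as ℤ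
import Data.Integer.Properties as ℤ
import Data.Integer.Tactic.RingSolver as ℤ-Solver
open import Data.Nat using (ℕ; zero; suc; _+_; _*_; _∸_; _≤_; _<_; _%_; _/_; z≤n; s≤s; _<ᵇ_; _≡ᵇ_; _<?_)
open import Data.Nat.DivMod using (m≡m%n+[m/n]*n; [m+kn]%n≡m%n; m*n/n≡m)
open import Data.Nat.Properties
open import Algebra.Properties.CommutativeSemigroup +-commutativeSemigroup using (interchange)
open import Data.Nat.Tactic.RingSolver using (solve-∀)
open import Data.Product using (∃; _×_; _,_; proj₁; proj₂)
open import Data.Rational.Unnormalised using (mkℚᵘ; *≤*; *<*)
import Data.Rational.Unnormalised as ℚᵘ
open import Data.Sum using (_⊎_; inj₁; inj₂; [_,_]′)
open import Data.Vec using ([]; _∷_; lookup)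
open import Function using (_∘_; id; _⇔_; mk⇔; Equivalence)
import Function.Properties.Equivalence as ⇔
open import Relation.Binary.Definitions using (tri<; tri≈; tri>)
open import Relation.Binary.PropositionalEquality
open import Relation.Nullary using (yes; no)

open Equivalence using (to; from)

sumFin-cong : ∀ n {f g : Fin n → ℕ} → (∀ i → f i ≡ g i) → sumFin n f ≡ sumFin n g
sumFin-cong zero    f≗g = refl
sumFin-cong (suc n) f≗g = cong₂ _+_ (f≗g zero) (sumFin-cong n (f≗g ∘ suc))

sumFin-mono : ∀ n {f g : Fin n → ℕ} → (∀ i → f i ≤ g i) → sumFin n f ≤ sumFin n g
sumFin-mono zero    f≤g = z≤n
sumFin-mono (suc n) f≤g = +-mono-≤ (f≤g zero) (sumFin-mono n (f≤g ∘ suc))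

sumFin-0 : ∀ n {f : Fin n → ℕ} → (∀ i → f i ≡ 0) → sumFin n f ≡ 0
sumFin-0 zero    f≗0 = refl
sumFin-0 (suc n) f≗0 = cong₂ _+_ (f≗0 zero) (sumFin-0 n (f≗0 ∘ suc))

sumFin-+ : ∀ n (f g : Fin n → ℕ) → sumFin n (λ i → f i + g i) ≡ sumFin n f + sumFin n g
sumFin-+ zero    f g = refl
sumFin-+ (suc n) f g =
  trans (cong (f zero + g zero +_) (sumFin-+ n (f ∘ suc) (g ∘ suc)))
        (interchange (f zero) (g zero) (sumFin n (f ∘ suc)) (sumFin n (g ∘ suc)))

sumFin-*ˡ : ∀ n c (f : Fin n → ℕ) → c * sumFin n f ≡ sumFin n (λ i → c * f i)
sumFin-*ˡ zero    c f = *-zeroʳ c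
sumFin-*ˡ (suc n) c f =
  trans (*-distribˡ-+ c (f zero) _) (cong (c * f zero +_) (sumFin-*ˡ n c (f ∘ suc)))

sumFin-swap : ∀ m n (f : Fin m → Fin n → ℕ) →
  sumFin m (λ i → sumFin n (f i)) ≡ sumFin n (λ j → sumFin m (λ i → f i j))
sumFin-swap zero    n f = sym (sumFin-0 n (λ _ → refl))
sumFin-swap (suc m) n f =
  trans (cong (sumFin n (f zero) +_) (sumFin-swap m n (f ∘ suc))) (sym (sumFin-+ n (f zero) _))

upper : ∀ {n} → (Fin n → Fin n → ℕ) → Fin n → Fin n → ℕ
upper g i j = if toℕ i <ᵇ toℕ j then g i j else 0

module _ {n} (g : Fin n → Fin n → ℕ) where

  upper-< : ∀ i j → toℕ i < toℕ j → upper g i j ≡ g i j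
  upper-< i j i<j with toℕ i <ᵇ toℕ j | <⇒<ᵇ i<j
  ... | true | _ = refl

  upper-≥ : ∀ i j → toℕ j ≤ toℕ i → upper g i j ≡ 0
  upper-≥ i j j≤i with toℕ i <ᵇ toℕ j in eq
  ... | false = refl
  ... | true  = ⊥-elim (<⇒≱ (<ᵇ⇒< (toℕ i) (toℕ j) (subst T (sym eq) _)) j≤i)

  module _ (g-sym : ∀ i j → g i j ≡ g j i) (g-diag : ∀ i → g i i ≡ 0) where

    upper+upperᵀ : ∀ i j → g i j ≡ upper g i j + upper g j i
    upper+upperᵀ i j with <-cmp (toℕ i) (toℕ j)
    ... | tri< i<j _ _ = sym (trans (cong₂ _+_ (upper-< i j i<j) (upper-≥ j i (<⇒≤ i<j))) (+-identityʳ _))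
    ... | tri> _ _ j<i = sym (trans (cong₂ _+_ (upper-≥ i j (<⇒≤ j<i)) (upper-< j i j<i)) (g-sym j i))
    ... | tri≈ _ i≡j _ rewrite Fin.toℕ-injective i≡j =
      sym (cong₂ _+_ (upper-≥ j j ≤-refl) (trans (upper-≥ j j ≤-refl) (sym (g-diag j))))

    2*sum-upper : 2 * sumFin n (λ i → sumFin n (upper g i)) ≡ sumFin n (λ i → sumFin n (g i))
    2*sum-upper = begin
      2 * U                                                          ≡⟨ cong (U +_) (+-identityʳ U) ⟩
      U + U                                                          ≡⟨ cong (U +_) (sumFin-swap n n (upper g)) ⟩
      U + sumFin n (λ i → sumFin n (λ j → upper g j i))              ≡⟨ sym (sumFin-+ n _ _) ⟩
      sumFin n (λ i → sumFin n (upper g i) + sumFin n (λ j → upper g j i))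
        ≡⟨ sumFin-cong n (λ i → sym (sumFin-+ n _ _)) ⟩
      sumFin n (λ i → sumFin n (λ j → upper g i j + upper g j i))
        ≡⟨ sumFin-cong n (λ i → sumFin-cong n (λ j → sym (upper+upperᵀ i j))) ⟩
      sumFin n (λ i → sumFin n (g i))                                ∎
      where
      open ≡-Reasoning
      U : ℕ
      U = sumFin n (λ i → sumFin n (upper g i))

[∈⊤]≡1 : ∀ {n} (w : Fin n) → [ w ∈ ⊤ ] ≡ 1
[∈⊤]≡1 zero    = refl
[∈⊤]≡1 (suc w) = [∈⊤]≡1 w

[∈]+[∈∁]≡1 : ∀ {n} (X : Subset n) w → [ w ∈ X ] + [ w ∈ ∁ X ] ≡ 1
[∈]+[∈∁]≡1 (true  ∷ X) zero    = refl
[∈]+[∈∁]≡1 (false ∷ X) zero    = refl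
[∈]+[∈∁]≡1 (_     ∷ X) (suc w) = [∈]+[∈∁]≡1 X w

[∈∁∁]≡[∈] : ∀ {n} (X : Subset n) w → [ w ∈ ∁ (∁ X) ] ≡ [ w ∈ X ]
[∈∁∁]≡[∈] (true  ∷ X) zero    = refl
[∈∁∁]≡[∈] (false ∷ X) zero    = refl
[∈∁∁]≡[∈] (_     ∷ X) (suc w) = [∈∁∁]≡[∈] X w

[∈]≤size : ∀ {n} (X : Subset n) w → [ w ∈ X ] ≤ size X
[∈]≤size (true  ∷ X) zero    = s≤s z≤n
[∈]≤size (false ∷ X) zero    = z≤n
[∈]≤size (true  ∷ X) (suc w) = m≤n⇒m≤1+n ([∈]≤size X w)
[∈]≤size (false ∷ X) (suc w) = [∈]≤size X w

[∈]+[∈]≤size : ∀ {n} (X : Subset n) {u w} → u ≢ w → [ u ∈ X ] + [ w ∈ X ] ≤ size X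
[∈]+[∈]≤size (_     ∷ X) {zero}  {zero}  u≢w = ⊥-elim (u≢w refl)
[∈]+[∈]≤size (true  ∷ X) {zero}  {suc w} u≢w = s≤s ([∈]≤size X w)
[∈]+[∈]≤size (false ∷ X) {zero}  {suc w} u≢w = [∈]≤size X w
[∈]+[∈]≤size (true  ∷ X) {suc u} {zero}  u≢w = subst (_≤ suc (size X)) (+-comm 1 _) (s≤s ([∈]≤size X u))
[∈]+[∈]≤size (false ∷ X) {suc u} {zero}  u≢w = subst (_≤ size X) (sym (+-identityʳ _)) ([∈]≤size X u)
[∈]+[∈]≤size (true  ∷ X) {suc u} {suc w} u≢w = m≤n⇒m≤1+n ([∈]+[∈]≤size X (u≢w ∘ cong suc))
[∈]+[∈]≤size (false ∷ X) {suc u} {suc w} u≢w = [∈]+[∈]≤size X (u≢w ∘ cong suc)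

sumFin-[∈]≡size : ∀ {n} (X : Subset n) → sumFin n (λ w → [ w ∈ X ]) ≡ size X
sumFin-[∈]≡size []          = refl
sumFin-[∈]≡size (true  ∷ X) = cong suc (sumFin-[∈]≡size X)
sumFin-[∈]≡size (false ∷ X) = sumFin-[∈]≡size X

𝟙 : ∀ {n} → Subset n → Fin n → ℕ
𝟙 X w = [ w ∈ X ]

record DisjointUnion {n} (A B C : Subset n) : Set where
  constructor disjointUnion
  field split : ∀ w → 𝟙 A w ≡ 𝟙 B w + 𝟙 C w
open DisjointUnion

⊤≐X⊎∁X : ∀ {n} (X : Subset n) → DisjointUnion ⊤ X (∁ X)
⊤≐X⊎∁X X = disjointUnion (λ w → trans ([∈⊤]≡1 w) (sym ([∈]+[∈∁]≡1 X w)))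

size-DisjointUnion : ∀ {n} {A B C : Subset n} → DisjointUnion A B C → size A ≡ size B + size C
size-DisjointUnion {n} {A} {B} {C} A≐B⊎C = begin
  size A                                                  ≡⟨ sym (sumFin-[∈]≡size A) ⟩
  sumFin n (λ w → [ w ∈ A ])                              ≡⟨ sumFin-cong n (split A≐B⊎C) ⟩
  sumFin n (λ w → [ w ∈ B ] + [ w ∈ C ])                  ≡⟨ sumFin-+ n _ _ ⟩
  sumFin n (λ w → [ w ∈ B ]) + sumFin n (λ w → [ w ∈ C ]) ≡⟨ cong₂ _+_ (sumFin-[∈]≡size B) (sumFin-[∈]≡size C) ⟩
  size B + size C                                         ∎
  where open ≡-Reasoning

-- The image of T ⊆ Fin (size C) under elems C.
spread : ∀ {n} (C : Subset n) → Subset (size C) → Subset n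
spread []          T       = []
spread (true  ∷ C) (b ∷ T) = b ∷ spread C T
spread (false ∷ C) T       = false ∷ spread C T

size-spread : ∀ {n} (C : Subset n) T → size (spread C T) ≡ size T
size-spread []          []          = refl
size-spread (true  ∷ C) (true  ∷ T) = cong suc (size-spread C T)
size-spread (true  ∷ C) (false ∷ T) = size-spread C T
size-spread (false ∷ C) T           = size-spread C T

spread∪∁≐spread⊎∁ : ∀ {n} (C : Subset n) T → DisjointUnion (spread C T ∪ ∁ C) (spread C T) (∁ C)
spread∪∁≐spread⊎∁ C T = disjointUnion (pointwise C T)
  where
  pointwise : ∀ {n} (C : Subset n) T w → 𝟙 (spread C T ∪ ∁ C) w ≡ 𝟙 (spread C T) w + 𝟙 (∁ C) w
  pointwise (true  ∷ C) (true  ∷ T) zero    = refl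
  pointwise (true  ∷ C) (false ∷ T) zero    = refl
  pointwise (false ∷ C) T           zero    = refl
  pointwise (true  ∷ C) (_ ∷ T)     (suc w) = pointwise C T w
  pointwise (false ∷ C) T           (suc w) = pointwise C T w

C≐spread⊎spread∁ : ∀ {n} (C : Subset n) T → DisjointUnion C (spread C T) (spread C (∁ T))
C≐spread⊎spread∁ C T = disjointUnion (pointwise C T)
  where
  pointwise : ∀ {n} (C : Subset n) T w → 𝟙 C w ≡ 𝟙 (spread C T) w + 𝟙 (spread C (∁ T)) w
  pointwise (true  ∷ C) (true  ∷ T) zero    = refl
  pointwise (true  ∷ C) (false ∷ T) zero    = refl
  pointwise (false ∷ C) T           zero    = refl
  pointwise (true  ∷ C) (_ ∷ T)     (suc w) = pointwise C T w
  pointwise (false ∷ C) T           (suc w) = pointwise C T w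

DisjointUnion-∁∁ˡ : ∀ {n} {A B C : Subset n} → DisjointUnion (∁ (∁ A)) B C → DisjointUnion A B C
DisjointUnion-∁∁ˡ {A = A} A≐B⊎C = disjointUnion (λ w → trans (sym ([∈∁∁]≡[∈] A w)) (split A≐B⊎C w))

DisjointUnion-∁∁ʳ : ∀ {n} {A B C : Subset n} → DisjointUnion A B (∁ (∁ C)) → DisjointUnion A B C
DisjointUnion-∁∁ʳ {B = B} {C} A≐B⊎C =
  disjointUnion (λ w → trans (split A≐B⊎C w) (cong (𝟙 B w +_) ([∈∁∁]≡[∈] C w)))

sumFin-elems : ∀ {n} (C : Subset n) (h : Fin n → ℕ) →
  sumFin (size C) (h ∘ elems C) ≡ sumFin n (λ w → [ w ∈ C ] * h w)
sumFin-elems []          h = refl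
sumFin-elems (true  ∷ C) h = cong₂ _+_ (sym (+-identityʳ (h zero))) (sumFin-elems C (h ∘ suc))
sumFin-elems (false ∷ C) h = sumFin-elems C (h ∘ suc)

sumFin-elems-spread : ∀ {n} (C : Subset n) (T : Subset (size C)) (h : Fin n → ℕ) →
  sumFin (size C) (λ j → [ j ∈ T ] * h (elems C j)) ≡ sumFin n (λ w → [ w ∈ spread C T ] * h w)
sumFin-elems-spread []          []      h = refl
sumFin-elems-spread (true  ∷ C) (b ∷ T) h = cong (_ +_) (sumFin-elems-spread C T (h ∘ suc))
sumFin-elems-spread (false ∷ C) T       h = sumFin-elems-spread C T (h ∘ suc)

odd⇒≡suc[/2*2] : ∀ m → m % 2 ≡ 1 → m ≡ suc (m / 2 * 2)
odd⇒≡suc[/2*2] m m%2≡1 = trans (m≡m%n+[m/n]*n m 2) (cong (_+ m / 2 * 2) m%2≡1)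

OddBig⇔ : ∀ {n} {X : Subset n} → OddBig X ⇔ ∃ λ h → size X ≡ suc (suc h * 2)
OddBig⇔ {X = X} = mk⇔ to′ (λ (h , eq) → from′ h eq)
  where
  to′ : OddBig X → ∃ λ h → size X ≡ suc (suc h * 2)
  to′ (odd , 3≤) with size X / 2 | odd⇒≡suc[/2*2] (size X) odd
  ... | suc h | eq = h , eq
  ... | zero  | eq with s≤s () ← subst (3 ≤_) eq 3≤
  from′ : ∀ h → size X ≡ suc (suc h * 2) → OddBig X
  from′ h eq rewrite eq = [m+kn]%n≡m%n 1 (suc h) 2 , s≤s (s≤s (s≤s z≤n))

ℚᵘ-≤⇔ : ∀ a b c d → mkℚᵘ (ℤ.+ a) b ℚᵘ.≤ mkℚᵘ (ℤ.+ c) d ⇔ a * suc d ≤ c * suc b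
ℚᵘ-≤⇔ a b c d = mk⇔
  (λ { (*≤* p) → ℤ.drop‿+≤+ (subst₂ ℤ._≤_ (sym (ℤ.pos-* a (suc d))) (sym (ℤ.pos-* c (suc b))) p) })
  (λ p → *≤* (subst₂ ℤ._≤_ (ℤ.pos-* a (suc d)) (ℤ.pos-* c (suc b)) (+≤+ p)))

ℚᵘ-<⇔ : ∀ a b c d → mkℚᵘ (ℤ.+ a) b ℚᵘ.< mkℚᵘ (ℤ.+ c) d ⇔ a * suc d < c * suc b
ℚᵘ-<⇔ a b c d = mk⇔
  (λ { (*<* p) → ℤ.drop‿+<+ (subst₂ ℤ._<_ (sym (ℤ.pos-* a (suc d))) (sym (ℤ.pos-* c (suc b))) p) })
  (λ p → *<* (subst₂ ℤ._<_ (ℤ.pos-* a (suc d)) (ℤ.pos-* c (suc b)) (+<+ p)))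

m-n≤o-p⇒m+p≤o+n : ∀ m n o p → ℤ.+ m ℤ.- ℤ.+ n ℤ.≤ ℤ.+ o ℤ.- ℤ.+ p → m + p ≤ o + n
m-n≤o-p⇒m+p≤o+n m n o p m-n≤o-p = ℤ.drop‿+≤+
  (subst₂ ℤ._≤_ (cancel (ℤ.+ m) (ℤ.+ n) (ℤ.+ p)) (cancel′ (ℤ.+ o) (ℤ.+ p) (ℤ.+ n))
    (ℤ.+-monoˡ-≤ (ℤ.+ n ℤ.+ ℤ.+ p) m-n≤o-p))
  where
  cancel : ∀ (m n p : ℤ) → (m ℤ.- n) ℤ.+ (n ℤ.+ p) ≡ m ℤ.+ p
  cancel = ℤ-Solver.solve-∀
  cancel′ : ∀ (o p n : ℤ) → (o ℤ.- p) ℤ.+ (n ℤ.+ p) ≡ o ℤ.+ n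
  cancel′ = ℤ-Solver.solve-∀

≡⇒⇔ : ∀ {A B : Set} → A ≡ B → A ⇔ B
≡⇒⇔ refl = mk⇔ id id

module EdgeCount {n} (H : Multigraph n) where

  degᵇ : (Fin n → ℕ) → Fin n → ℕ
  degᵇ b u = sumFin n (λ w → b w * mult H u w)

  ⟪_,_⟫ : (Fin n → ℕ) → (Fin n → ℕ) → ℕ
  ⟪ a , b ⟫ = sumFin n (λ u → a u * degᵇ b u)

  -- For disjoint X and Y this counts the X–Y edges, while e⟨ X , X ⟩ = 2 e(⟨X⟩).
  e⟨_,_⟩ : Subset n → Subset n → ℕ
  e⟨ X , Y ⟩ = ⟪ 𝟙 X , 𝟙 Y ⟫

  degᵇ-cong : ∀ {b b′} → (∀ w → b w ≡ b′ w) → ∀ u → degᵇ b u ≡ degᵇ b′ u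
  degᵇ-cong b≗b′ u = sumFin-cong n (λ w → cong (_* mult H u w) (b≗b′ w))

  ⟪⟫-cong : ∀ {a a′ b b′} → (∀ w → a w ≡ a′ w) → (∀ w → b w ≡ b′ w) → ⟪ a , b ⟫ ≡ ⟪ a′ , b′ ⟫
  ⟪⟫-cong a≗a′ b≗b′ = sumFin-cong n (λ u → cong₂ _*_ (a≗a′ u) (degᵇ-cong b≗b′ u))

  ⟪⟫-+ˡ : ∀ a a′ b → ⟪ (λ w → a w + a′ w) , b ⟫ ≡ ⟪ a , b ⟫ + ⟪ a′ , b ⟫
  ⟪⟫-+ˡ a a′ b = trans (sumFin-cong n (λ u → *-distribʳ-+ (degᵇ b u) (a u) (a′ u))) (sumFin-+ n _ _)

  degᵇ-+ : ∀ b b′ u → degᵇ (λ w → b w + b′ w) u ≡ degᵇ b u + degᵇ b′ u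
  degᵇ-+ b b′ u = trans (sumFin-cong n (λ w → *-distribʳ-+ (mult H u w) (b w) (b′ w))) (sumFin-+ n _ _)

  degᵇ-split : ∀ {A B C} → DisjointUnion A B C → ∀ u → degᵇ (𝟙 A) u ≡ degᵇ (𝟙 B) u + degᵇ (𝟙 C) u
  degᵇ-split {B = B} {C} A≐B⊎C u = trans (degᵇ-cong (split A≐B⊎C) u) (degᵇ-+ (𝟙 B) (𝟙 C) u)

  deg≡degᵇ⊤ : ∀ u → deg H u ≡ degᵇ (𝟙 ⊤) u
  deg≡degᵇ⊤ u = sumFin-cong n (λ w → sym (trans (cong (_* mult H u w) ([∈⊤]≡1 w)) (*-identityˡ _)))

  ⟪⟫-+ʳ : ∀ a b b′ → ⟪ a , (λ w → b w + b′ w) ⟫ ≡ ⟪ a , b ⟫ + ⟪ a , b′ ⟫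
  ⟪⟫-+ʳ a b b′ = trans (sumFin-cong n λ u → trans (cong (a u *_) (degᵇ-+ b b′ u)) (*-distribˡ-+ (a u) _ _))
                       (sumFin-+ n _ _)

  ⟪⟫-expand : ∀ a b → ⟪ a , b ⟫ ≡ sumFin n (λ u → sumFin n (λ w → a u * (b w * mult H u w)))
  ⟪⟫-expand a b = sumFin-cong n (λ u → sumFin-*ˡ n (a u) _)

  ⟪⟫-comm : ∀ a b → ⟪ a , b ⟫ ≡ ⟪ b , a ⟫
  ⟪⟫-comm a b = begin
    ⟪ a , b ⟫                                                     ≡⟨ ⟪⟫-expand a b ⟩
    sumFin n (λ u → sumFin n (λ w → a u * (b w * mult H u w)))    ≡⟨ sumFin-swap n n _ ⟩
    sumFin n (λ w → sumFin n (λ u → a u * (b w * mult H u w)))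
      ≡⟨ sumFin-cong n (λ w → sumFin-cong n (λ u →
           trans (cong (λ m → a u * (b w * m)) (Multigraph.sym H u w)) (x*[y*z]≡y*[x*z] (a u) (b w) (mult H w u)))) ⟩
    sumFin n (λ w → sumFin n (λ u → b w * (a u * mult H w u)))    ≡⟨ sym (⟪⟫-expand b a) ⟩
    ⟪ b , a ⟫                                                     ∎
    where
    open ≡-Reasoning
    x*[y*z]≡y*[x*z] : ∀ x y z → x * (y * z) ≡ y * (x * z)
    x*[y*z]≡y*[x*z] = solve-∀

  e⟨⟩-comm : ∀ X Y → e⟨ X , Y ⟩ ≡ e⟨ Y , X ⟩
  e⟨⟩-comm X Y = ⟪⟫-comm (𝟙 X) (𝟙 Y)

  e⟨⟩-∁∁ˡ : ∀ X Y → e⟨ ∁ (∁ X) , Y ⟩ ≡ e⟨ X , Y ⟩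
  e⟨⟩-∁∁ˡ X Y = ⟪⟫-cong {b = 𝟙 Y} {b′ = 𝟙 Y} ([∈∁∁]≡[∈] X) (λ _ → refl)

  e⟨⟩-splitˡ : ∀ {A B C} Y → DisjointUnion A B C → e⟨ A , Y ⟩ ≡ e⟨ B , Y ⟩ + e⟨ C , Y ⟩
  e⟨⟩-splitˡ {A} {B} {C} Y A≐B⊎C =
    trans (⟪⟫-cong {b = 𝟙 Y} {b′ = 𝟙 Y} (split A≐B⊎C) (λ _ → refl)) (⟪⟫-+ˡ (𝟙 B) (𝟙 C) (𝟙 Y))

  e⟨⟩-splitʳ : ∀ {A B C} X → DisjointUnion A B C → e⟨ X , A ⟩ ≡ e⟨ X , B ⟩ + e⟨ X , C ⟩
  e⟨⟩-splitʳ {A} {B} {C} X A≐B⊎C =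
    trans (⟪⟫-cong {a = 𝟙 X} {a′ = 𝟙 X} (λ _ → refl) (split A≐B⊎C)) (⟪⟫-+ʳ (𝟙 X) (𝟙 B) (𝟙 C))

  e⟨⟩-union : ∀ {A B C} → DisjointUnion A B C →
    e⟨ A , A ⟩ ≡ e⟨ B , B ⟩ + 2 * e⟨ B , C ⟩ + e⟨ C , C ⟩
  e⟨⟩-union {A} {B} {C} A≐B⊎C = begin
    e⟨ A , A ⟩                                              ≡⟨ e⟨⟩-splitˡ A A≐B⊎C ⟩
    e⟨ B , A ⟩ + e⟨ C , A ⟩
      ≡⟨ cong₂ _+_ (e⟨⟩-splitʳ B A≐B⊎C) (e⟨⟩-splitʳ C A≐B⊎C) ⟩
    (e⟨ B , B ⟩ + e⟨ B , C ⟩) + (e⟨ C , B ⟩ + e⟨ C , C ⟩)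
      ≡⟨ cong (λ m → e⟨ B , B ⟩ + e⟨ B , C ⟩ + (m + e⟨ C , C ⟩)) (e⟨⟩-comm C B) ⟩
    (e⟨ B , B ⟩ + e⟨ B , C ⟩) + (e⟨ B , C ⟩ + e⟨ C , C ⟩) ≡⟨ regroup e⟨ B , B ⟩ e⟨ B , C ⟩ e⟨ C , C ⟩ ⟩
    e⟨ B , B ⟩ + 2 * e⟨ B , C ⟩ + e⟨ C , C ⟩                ∎
    where
    open ≡-Reasoning
    regroup : ∀ x y z → (x + y) + (y + z) ≡ x + 2 * y + z
    regroup = solve-∀

  degree-sum≤ : ∀ {k} → MaxDegLe H k → ∀ X → e⟨ X , ⊤ ⟩ ≤ k * size X
  degree-sum≤ {k} Δ≤k X = begin
    e⟨ X , ⊤ ⟩                                    ≤⟨ sumFin-mono n (λ u → *-monoʳ-≤ [ u ∈ X ] (deg≤k u)) ⟩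
    sumFin n (λ u → [ u ∈ X ] * k)               ≡⟨ sumFin-cong n (λ u → *-comm [ u ∈ X ] k) ⟩
    sumFin n (λ u → k * [ u ∈ X ])               ≡⟨ sym (sumFin-*ˡ n k (𝟙 X)) ⟩
    k * sumFin n (λ u → [ u ∈ X ])               ≡⟨ cong (k *_) (sumFin-[∈]≡size X) ⟩
    k * size X                                   ∎
    where
    open ≤-Reasoning
    deg≤k : ∀ u → degᵇ (𝟙 ⊤) u ≤ k
    deg≤k u = subst (_≤ k) (deg≡degᵇ⊤ u) (Δ≤k u)

  2*eInd≡e⟨⟩ : ∀ X → 2 * eInd H X ≡ e⟨ X , X ⟩
  2*eInd≡e⟨⟩ X = begin
    2 * eInd H X                           ≡⟨ cong (2 *_) (sumFin-cong n (λ i → sumFin-cong n (masked i))) ⟩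
    2 * sumFin n (λ i → sumFin n (upper g i)) ≡⟨ 2*sum-upper g g-sym g-diag ⟩
    sumFin n (λ i → sumFin n (g i))        ≡⟨ sym (⟪⟫-expand (𝟙 X) (𝟙 X)) ⟩
    e⟨ X , X ⟩                             ∎
    where
    open ≡-Reasoning
    g : Fin n → Fin n → ℕ
    g i j = [ i ∈ X ] * ([ j ∈ X ] * mult H i j)
    g-sym : ∀ i j → g i j ≡ g j i
    g-sym i j = trans (cong (λ m → [ i ∈ X ] * ([ j ∈ X ] * m)) (Multigraph.sym H i j))
                      (swap [ i ∈ X ] [ j ∈ X ] (mult H j i))
      where
      swap : ∀ x y z → x * (y * z) ≡ y * (x * z)
      swap = solve-∀
    g-diag : ∀ i → g i i ≡ 0
    g-diag i rewrite Multigraph.loopless H i | *-zeroʳ [ i ∈ X ] = *-zeroʳ [ i ∈ X ]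
    masked : ∀ i j → [ i ∈ X ] * [ j ∈ X ] * (if toℕ i <ᵇ toℕ j then mult H i j else 0) ≡ upper g i j
    masked i j with toℕ i <ᵇ toℕ j
    ... | true  = *-assoc [ i ∈ X ] [ j ∈ X ] (mult H i j)
    ... | false = *-zeroʳ ([ i ∈ X ] * [ j ∈ X ])

  e⟨⟩-singleton : ∀ X → size X ≡ 1 → e⟨ X , X ⟩ ≡ 0
  e⟨⟩-singleton X |X|≡1 = trans (⟪⟫-expand (𝟙 X) (𝟙 X)) (sumFin-0 n λ u → sumFin-0 n λ w → term u w)
    where
    term : ∀ u w → [ u ∈ X ] * ([ w ∈ X ] * mult H u w) ≡ 0
    term u w with u Fin.≟ w
    ... | yes refl rewrite Multigraph.loopless H u | *-zeroʳ [ u ∈ X ] = *-zeroʳ [ u ∈ X ]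
    ... | no u≢w = at-most-one [ u ∈ X ] [ w ∈ X ] (subst ([ u ∈ X ] + [ w ∈ X ] ≤_) |X|≡1 ([∈]+[∈]≤size X u≢w))
      where
      at-most-one : ∀ a b → a + b ≤ 1 → a * (b * mult H u w) ≡ 0
      at-most-one zero    b       _         = refl
      at-most-one (suc a) zero    _         = *-zeroʳ (suc a)
      at-most-one (suc a) (suc b) (s≤s a+1+b≤0) with () ← subst (_≤ 0) (+-suc a b) a+1+b≤0

  t≤ℕ⇔ : ∀ {X m} q → size X ≡ suc (suc m) → t H X ℚᵘ.≤ ℕtoℚ q ⇔ e⟨ X , X ⟩ ≤ q * suc m
  t≤ℕ⇔ {X} q |X|≡ = ⇔.trans (ℚᵘ-≤⇔ (2 * eInd H X) (size X ∸ 2) q 0)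
    (≡⇒⇔ (cong₂ _≤_ (trans (*-identityʳ _) (2*eInd≡e⟨⟩ X)) (cong (λ s → q * suc (s ∸ 2)) |X|≡)))

  ℕ<t⇔ : ∀ {X m} q → size X ≡ suc (suc m) → ℕtoℚ q ℚᵘ.< t H X ⇔ q * suc m < e⟨ X , X ⟩
  ℕ<t⇔ {X} q |X|≡ = ⇔.trans (ℚᵘ-<⇔ q 0 (2 * eInd H X) (size X ∸ 2))
    (≡⇒⇔ (cong₂ _<_ (cong (λ s → q * suc (s ∸ 2)) |X|≡) (trans (*-identityʳ _) (2*eInd≡e⟨⟩ X))))

  Overfull⇔ : ∀ {X k} →
    Overfull H k X ⇔ ∃ λ h → size X ≡ suc (suc h * 2) × k * (suc h * 2) < e⟨ X , X ⟩
  Overfull⇔ {X} {k} = mk⇔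
    (λ (odd , dense) → let h , |X|≡ = to (OddBig⇔ {X = X}) odd in h , |X|≡ , to (ℕ<t⇔ {X} k |X|≡) dense)
    (λ (h , |X|≡ , dense) → from (OddBig⇔ {X = X}) (h , |X|≡) , from (ℕ<t⇔ {X} k |X|≡) dense)

  overfull-or-sparse : ∀ k X x → size X ≡ suc (x * 2) → Overfull H k X ⊎ e⟨ X , X ⟩ ≤ k * (x * 2)
  overfull-or-sparse k X zero    |X|≡1 = inj₂ (≤-reflexive (trans (e⟨⟩-singleton X |X|≡1) (sym (*-zeroʳ k))))
  overfull-or-sparse k X (suc x) |X|≡ with k * (suc x * 2) <? e⟨ X , X ⟩
  ... | yes dense = inj₁ (from (Overfull⇔ {X}) (x , |X|≡ , dense))
  ... | no ¬dense = inj₂ (≮⇒≥ ¬dense)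

  -- For |X| = 2a + 1 the slack is (k + 1) a − e(⟨X⟩); doubling turns e(⟨X⟩) into e⟨ X , X ⟩.
  slack≤⇒ : ∀ k X Y {a b} → size X ≡ suc (a * 2) → size Y ≡ suc (b * 2) →
    slack H X k ℤ.≤ slack H Y k → suc k * (a * 2) + e⟨ Y , Y ⟩ ≤ suc k * (b * 2) + e⟨ X , X ⟩
  slack≤⇒ k X Y {a} {b} |X|≡ |Y|≡ sl≤ =
    subst₂ _≤_ (double a Y) (double b X) (*-monoʳ-≤ 2
      (subst₂ (λ x y → (k + 1) * x + eInd H Y ≤ (k + 1) * y + eInd H X) (half X |X|≡) (half Y |Y|≡)
        (m-n≤o-p⇒m+p≤o+n ((k + 1) * ((size X ∸ 1) / 2)) (eInd H X)
                         ((k + 1) * ((size Y ∸ 1) / 2)) (eInd H Y) sl≤)))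
    where
    half : ∀ Z {c} → size Z ≡ suc (c * 2) → (size Z ∸ 1) / 2 ≡ c
    half Z {c} |Z|≡ = trans (cong (λ s → (s ∸ 1) / 2) |Z|≡) (m*n/n≡m c 2)
    double : ∀ c Z → 2 * ((k + 1) * c + eInd H Z) ≡ suc k * (c * 2) + e⟨ Z , Z ⟩
    double c Z = trans (*-distribˡ-+ 2 ((k + 1) * c) (eInd H Z)) (cong₂ _+_ (reorder k c) (2*eInd≡e⟨⟩ Z))
      where
      reorder : ∀ k c → 2 * ((k + 1) * c) ≡ suc k * (c * 2)
      reorder = solve-∀

module Shrinking {n} (H : Multigraph n) (X : Subset n) where

  open EdgeCount H
  private
    module H′ = EdgeCount (shrink H X)
    C : Subset n
    C = ∁ X
    m : ℕ
    m = size C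

  deg-shrink-new : deg (shrink H X) zero ≡ e⟨ ∁ X , X ⟩
  deg-shrink-new = sumFin-elems C (degᵇ (𝟙 X))

  deg-shrink-old : ∀ i → deg (shrink H X) (suc i) ≡ deg H (elems (∁ X) i)
  deg-shrink-old i = begin
    deg (shrink H X) (suc i)    ≡⟨ cong (degᵇ (𝟙 X) v +_) (sumFin-elems C (mult H v)) ⟩
    degᵇ (𝟙 X) v + degᵇ (𝟙 C) v ≡⟨ sym (degᵇ-split (⊤≐X⊎∁X X) v) ⟩
    degᵇ (𝟙 ⊤) v                ≡⟨ sym (deg≡degᵇ⊤ v) ⟩
    deg H v                     ∎
    where
    open ≡-Reasoning
    v : Fin n
    v = elems C i

  e⟨⟩-shrink-without : ∀ T → H′.e⟨ false ∷ T , false ∷ T ⟩ ≡ e⟨ spread (∁ X) T , spread (∁ X) T ⟩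
  e⟨⟩-shrink-without T = begin
    H′.e⟨ false ∷ T , false ∷ T ⟩
      ≡⟨ sumFin-cong m (λ i → cong ([ i ∈ T ] *_) (sumFin-elems-spread C T (mult H (elems C i)))) ⟩
    sumFin m (λ i → [ i ∈ T ] * degᵇ (𝟙 T′) (elems C i)) ≡⟨ sumFin-elems-spread C T (degᵇ (𝟙 T′)) ⟩
    e⟨ T′ , T′ ⟩                                         ∎
    where
    open ≡-Reasoning
    T′ : Subset n
    T′ = spread C T

  e⟨⟩-shrink-with : ∀ T →
    H′.e⟨ true ∷ T , true ∷ T ⟩ ≡ e⟨ spread (∁ X) T , spread (∁ X) T ⟩ + 2 * e⟨ spread (∁ X) T , X ⟩
  e⟨⟩-shrink-with T = begin
    H′.e⟨ true ∷ T , true ∷ T ⟩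
      ≡⟨ cong₂ _+_ (trans (*-identityˡ _) (sumFin-elems-spread C T (degᵇ (𝟙 X))))
           (sumFin-cong m (λ i → cong ([ i ∈ T ] *_)
              (cong₂ _+_ (*-identityˡ _) (sumFin-elems-spread C T (mult H (elems C i)))))) ⟩
    e⟨ T′ , X ⟩ + sumFin m (λ i → [ i ∈ T ] * (degᵇ (𝟙 X) (elems C i) + degᵇ (𝟙 T′) (elems C i)))
      ≡⟨ cong (e⟨ T′ , X ⟩ +_) (sumFin-elems-spread C T (λ w → degᵇ (𝟙 X) w + degᵇ (𝟙 T′) w)) ⟩
    e⟨ T′ , X ⟩ + sumFin n (λ w → 𝟙 T′ w * (degᵇ (𝟙 X) w + degᵇ (𝟙 T′) w))
      ≡⟨ cong (e⟨ T′ , X ⟩ +_) (trans (sumFin-cong n (λ w → *-distribˡ-+ (𝟙 T′ w) _ _)) (sumFin-+ n _ _)) ⟩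
    e⟨ T′ , X ⟩ + (e⟨ T′ , X ⟩ + e⟨ T′ , T′ ⟩) ≡⟨ regroup e⟨ T′ , X ⟩ e⟨ T′ , T′ ⟩ ⟩
    e⟨ T′ , T′ ⟩ + 2 * e⟨ T′ , X ⟩            ∎
    where
    open ≡-Reasoning
    T′ : Subset n
    T′ = spread C T
    regroup : ∀ x y → x + (x + y) ≡ y + 2 * x
    regroup = solve-∀

  t-shrink-without : ∀ T → t (shrink H X) (false ∷ T) ≡ t H (spread (∁ X) T)
  t-shrink-without T = cong₂ (λ e s → mkℚᵘ (ℤ.+ e) (s ∸ 2))
    (trans (H′.2*eInd≡e⟨⟩ (false ∷ T)) (trans (e⟨⟩-shrink-without T) (sym (2*eInd≡e⟨⟩ (spread C T)))))
    (sym (size-spread C T))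

  shrink-MaxDegLe : ∀ {k} → MaxDegLe H k → e⟨ ∁ X , X ⟩ ≤ k → MaxDegLe (shrink H X) k
  shrink-MaxDegLe Δ≤k cut≤k zero    = subst (_≤ _) (sym deg-shrink-new) cut≤k
  shrink-MaxDegLe Δ≤k cut≤k (suc i) = subst (_≤ _) (sym (deg-shrink-old i)) (Δ≤k (elems C i))

  numDeg-shrink≤ : ∀ {k} → e⟨ ∁ X , X ⟩ < k → numDeg (shrink H X) k ≤ numDeg H k
  numDeg-shrink≤ {k} cut<k = begin
    numDeg (shrink H X) k
      ≡⟨ cong (_+ sumFin m (λ i → is-k (deg (shrink H X) (suc i)))) new-vertex-not-counted ⟩
    sumFin m (λ i → is-k (deg (shrink H X) (suc i))) ≡⟨ sumFin-cong m (cong is-k ∘ deg-shrink-old) ⟩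
    sumFin m (λ i → is-k (deg H (elems C i)))        ≡⟨ sumFin-elems C (is-k ∘ deg H) ⟩
    sumFin n (λ w → [ w ∈ C ] * is-k (deg H w))
      ≤⟨ sumFin-mono n (λ w → *-monoˡ-≤ (is-k (deg H w)) ([∈]≤1 C w)) ⟩
    sumFin n (λ w → 1 * is-k (deg H w))              ≡⟨ sumFin-cong n (λ w → *-identityˡ _) ⟩
    numDeg H k                                       ∎
    where
    open ≤-Reasoning
    is-k : ℕ → ℕ
    is-k d = if d ≡ᵇ k then 1 else 0
    [∈]≤1 : ∀ {n} (Y : Subset n) w → [ w ∈ Y ] ≤ 1
    [∈]≤1 Y w with lookup Y w
    ... | true  = ≤-refl
    ... | false = z≤n
    new-vertex-not-counted : is-k (deg (shrink H X) zero) ≡ 0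
    new-vertex-not-counted with deg (shrink H X) zero ≡ᵇ k in eq
    ... | false = refl
    ... | true  = ⊥-elim (<-irrefl (≡ᵇ⇒≡ _ k (subst T (sym eq) _))
                                   (subst (_< k) (sym deg-shrink-new) cut<k))

  -- t(⟨{s} ∪ T⟩) ≤ q in the shrinking, for every even T ⊆ V ∖ X, where s is the new vertex.
  BoundedWithNewVertex : ℕ → Set
  BoundedWithNewVertex q = ∀ T h → size T ≡ h * 2 →
    e⟨ spread (∁ X) T , spread (∁ X) T ⟩ + 2 * e⟨ spread (∁ X) T , X ⟩ ≤ q * (h * 2)

  shrink-GammaLe : ∀ {q} → GammaLe H (ℕtoℚ q) → BoundedWithNewVertex q → GammaLe (shrink H X) (ℕtoℚ q)
  shrink-GammaLe {q} Γ≤q _ (false ∷ T) odd =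
    subst (ℚᵘ._≤ ℕtoℚ q) (sym (t-shrink-without T))
      (Γ≤q (spread C T) (subst (λ s → (s % 2 ≡ 1) × (3 ≤ s)) (sym (size-spread C T)) odd))
  shrink-GammaLe {q} _ even-bound (true ∷ T) odd =
    from (H′.t≤ℕ⇔ {true ∷ T} q |T|+1≡)
      (subst (_≤ q * (suc h * 2)) (sym (e⟨⟩-shrink-with T)) (even-bound T (suc h) (suc-injective |T|+1≡)))
    where
    h : ℕ
    h = proj₁ (to (OddBig⇔ {X = true ∷ T}) odd)
    |T|+1≡ : suc (size T) ≡ suc (suc h * 2)
    |T|+1≡ = proj₂ (to (OddBig⇔ {X = true ∷ T}) odd)

module MinimalOverfull {n} (H : Multigraph n) (k : ℕ) (S : Subset n)
  (S-overfull : Overfull H k S)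
  (S-minimal : ∀ T → Overfull H k T → slack H S k ℤ.≤ slack H T k) where

  open EdgeCount H

  private
    S-shape : ∃ λ h → size S ≡ suc (suc h * 2) × k * (suc h * 2) < e⟨ S , S ⟩
    S-shape = to (Overfull⇔ {S}) S-overfull
    hS : ℕ
    hS = proj₁ S-shape
    |S|≡ : size S ≡ suc (suc hS * 2)
    |S|≡ = proj₁ (proj₂ S-shape)
    S-dense : k * (suc hS * 2) < e⟨ S , S ⟩
    S-dense = proj₂ (proj₂ S-shape)

  cut<k : MaxDegLe H k → e⟨ S , ∁ S ⟩ < k
  cut<k Δ≤k = +-cancelˡ-< (k * (suc hS * 2)) _ _ (begin-strict
    k * (suc hS * 2) + e⟨ S , ∁ S ⟩ <⟨ +-monoˡ-< e⟨ S , ∁ S ⟩ S-dense ⟩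
    e⟨ S , S ⟩ + e⟨ S , ∁ S ⟩       ≡⟨ sym (e⟨⟩-splitʳ S (⊤≐X⊎∁X S)) ⟩
    e⟨ S , ⊤ ⟩                      ≤⟨ degree-sum≤ Δ≤k S ⟩
    k * size S                      ≡⟨ cong (k *_) |S|≡ ⟩
    k * suc (suc hS * 2)            ≡⟨ *-suc k _ ⟩
    k + k * (suc hS * 2)            ≡⟨ +-comm k _ ⟩
    k * (suc hS * 2) + k            ∎)
    where open ≤-Reasoning

  outside-bound : ∀ {T U} h → DisjointUnion U T S → size T ≡ h * 2 →
    e⟨ T , T ⟩ + 2 * e⟨ T , S ⟩ ≤ suc k * (h * 2)
  outside-bound {T} {U} h U≐T⊎S |T|≡ =
    [ via-minimality , via-sparseness ]′ (overfull-or-sparse k U (suc (h + hS)) |U|≡)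
    where
    open ≤-Reasoning
    u a x : ℕ
    u = h * 2
    a = suc hS * 2
    x = e⟨ T , T ⟩ + 2 * e⟨ T , S ⟩
    |U|≡ : size U ≡ suc (suc (h + hS) * 2)
    |U|≡ = trans (size-DisjointUnion U≐T⊎S) (trans (cong₂ _+_ |T|≡ |S|≡) (sizes h hS))
      where
      sizes : ∀ h hS → h * 2 + suc (suc hS * 2) ≡ suc (suc (h + hS) * 2)
      sizes = solve-∀
    via-minimality : Overfull H k U → x ≤ suc k * u
    via-minimality U-overfull = +-cancelʳ-≤ e⟨ S , S ⟩ x (suc k * u) (+-cancelˡ-≤ (suc k * a) _ _ (begin
      suc k * a + (x + e⟨ S , S ⟩)      ≡⟨ cong (suc k * a +_) (sym (e⟨⟩-union U≐T⊎S)) ⟩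
      suc k * a + e⟨ U , U ⟩            ≤⟨ slack≤⇒ k S U {suc hS} {suc (h + hS)} |S|≡ |U|≡ (S-minimal U U-overfull) ⟩
      suc k * (suc (h + hS) * 2) + e⟨ S , S ⟩ ≡⟨ split-size k h hS e⟨ S , S ⟩ ⟩
      suc k * a + (suc k * u + e⟨ S , S ⟩) ∎))
      where
      split-size : ∀ k h hS e → suc k * (suc (h + hS) * 2) + e ≡ suc k * (suc hS * 2) + (suc k * (h * 2) + e)
      split-size = solve-∀
    via-sparseness : e⟨ U , U ⟩ ≤ k * (suc (h + hS) * 2) → x ≤ suc k * u
    via-sparseness U-sparse = ≤-trans (<⇒≤ (+-cancelʳ-< e⟨ S , S ⟩ x (k * u) (begin-strict
      x + e⟨ S , S ⟩             ≡⟨ sym (e⟨⟩-union U≐T⊎S) ⟩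
      e⟨ U , U ⟩                 ≤⟨ U-sparse ⟩
      k * (suc (h + hS) * 2)     ≡⟨ split-size k h hS ⟩
      k * u + k * a              <⟨ +-monoʳ-< (k * u) S-dense ⟩
      k * u + e⟨ S , S ⟩         ∎))) (*-monoˡ-≤ u (n≤1+n k))
      where
      split-size : ∀ k h hS → k * (suc (h + hS) * 2) ≡ k * (h * 2) + k * (suc hS * 2)
      split-size = solve-∀

  k*|T|+e⟨R,R⟩≤e⟨S,S⟩ : ∀ {T R} h → DisjointUnion S T R → size T ≡ h * 2 →
    k * (h * 2) + e⟨ R , R ⟩ ≤ e⟨ S , S ⟩
  k*|T|+e⟨R,R⟩≤e⟨S,S⟩ {T} {R} h S≐T⊎R |T|≡ =
    [ via-minimality , via-sparseness ]′ (overfull-or-sparse k R r |R|≡)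
    where
    open ≤-Reasoning
    u r : ℕ
    u = h * 2
    r = size R / 2
    |S|≡u+|R| : size S ≡ u + size R
    |S|≡u+|R| = trans (size-DisjointUnion S≐T⊎R) (cong (_+ size R) |T|≡)
    |R|≡ : size R ≡ suc (r * 2)
    |R|≡ = odd⇒≡suc[/2*2] (size R) (begin-equality
      size R % 2       ≡⟨ sym ([m+kn]%n≡m%n (size R) h 2) ⟩
      (size R + u) % 2 ≡⟨ cong (_% 2) (trans (+-comm (size R) u) (sym |S|≡u+|R|)) ⟩
      size S % 2       ≡⟨ proj₁ (proj₁ S-overfull) ⟩
      1                ∎)
    a≡u+r2 : suc hS * 2 ≡ u + r * 2
    a≡u+r2 = suc-injective (trans (sym |S|≡) (trans |S|≡u+|R| (trans (cong (u +_) |R|≡) (+-suc u (r * 2)))))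
    via-minimality : Overfull H k R → k * u + e⟨ R , R ⟩ ≤ e⟨ S , S ⟩
    via-minimality R-overfull = ≤-trans (+-monoˡ-≤ e⟨ R , R ⟩ (*-monoˡ-≤ u (n≤1+n k)))
      (+-cancelˡ-≤ (suc k * (r * 2)) _ _ (begin
        suc k * (r * 2) + (suc k * u + e⟨ R , R ⟩) ≡⟨ regroup k u (r * 2) e⟨ R , R ⟩ ⟩
        suc k * (u + r * 2) + e⟨ R , R ⟩           ≡⟨ cong (λ s → suc k * s + e⟨ R , R ⟩) (sym a≡u+r2) ⟩
        suc k * (suc hS * 2) + e⟨ R , R ⟩          ≤⟨ slack≤⇒ k S R {suc hS} {r} |S|≡ |R|≡ (S-minimal R R-overfull) ⟩
        suc k * (r * 2) + e⟨ S , S ⟩               ∎))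
      where
      regroup : ∀ k u r e → suc k * r + (suc k * u + e) ≡ suc k * (u + r) + e
      regroup = solve-∀
    via-sparseness : e⟨ R , R ⟩ ≤ k * (r * 2) → k * u + e⟨ R , R ⟩ ≤ e⟨ S , S ⟩
    via-sparseness R-sparse = <⇒≤ (begin-strict
      k * u + e⟨ R , R ⟩   ≤⟨ +-monoʳ-≤ (k * u) R-sparse ⟩
      k * u + k * (r * 2)  ≡⟨ sym (*-distribˡ-+ k u (r * 2)) ⟩
      k * (u + r * 2)      ≡⟨ cong (k *_) (sym a≡u+r2) ⟩
      k * (suc hS * 2)     <⟨ S-dense ⟩
      e⟨ S , S ⟩           ∎)

  -- With y = e⟨T,T⟩, z = e⟨T,R⟩, c = e⟨T,Sᶜ⟩: the degree bound gives y + z + c ≤ k|T|, and the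
  -- lemma above gives k|T| ≤ y + 2z; hence y + 2c ≤ k|T|.
  inside-bound : MaxDegLe H k → ∀ {T R} h → DisjointUnion S T R → size T ≡ h * 2 →
    e⟨ T , T ⟩ + 2 * e⟨ T , ∁ S ⟩ ≤ suc k * (h * 2)
  inside-bound Δ≤k {T} {R} h S≐T⊎R |T|≡ =
    ≤-trans (+-cancelʳ-≤ (y + 2 * z) (y + 2 * c) (k * u) (begin
      (y + 2 * c) + (y + 2 * z) ≡⟨ regroup y z c ⟩
      2 * (y + z + c)           ≤⟨ *-monoʳ-≤ 2 degree-bound ⟩
      2 * (k * u)               ≡⟨ cong (k * u +_) (+-identityʳ (k * u)) ⟩
      k * u + k * u             ≤⟨ +-monoʳ-≤ (k * u) k*u≤y+2z ⟩
      k * u + (y + 2 * z)       ∎)) (*-monoˡ-≤ u (n≤1+n k))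
    where
    open ≤-Reasoning
    u y z c : ℕ
    u = h * 2
    y = e⟨ T , T ⟩
    z = e⟨ T , R ⟩
    c = e⟨ T , ∁ S ⟩
    regroup : ∀ y z c → (y + 2 * c) + (y + 2 * z) ≡ 2 * (y + z + c)
    regroup = solve-∀
    degree-bound : y + z + c ≤ k * u
    degree-bound = subst₂ _≤_
      (trans (e⟨⟩-splitʳ T (⊤≐X⊎∁X S)) (cong (_+ c) (e⟨⟩-splitʳ T S≐T⊎R)))
      (cong (k *_) |T|≡)
      (degree-sum≤ Δ≤k T)
    k*u≤y+2z : k * u ≤ y + 2 * z
    k*u≤y+2z = +-cancelʳ-≤ e⟨ R , R ⟩ (k * u) (y + 2 * z)
      (subst (k * u + e⟨ R , R ⟩ ≤_) (e⟨⟩-union S≐T⊎R) (k*|T|+e⟨R,R⟩≤e⟨S,S⟩ h S≐T⊎R |T|≡))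

mainTheorem6 : (d n r : ℕ) (H : Multigraph n) →
    n % 2 ≡ 0 →
    MaxDegLe H (suc d) →
    numDeg H (suc d) ≡ r →
    GammaGt H (ℕtoℚ (suc d)) →
    GammaLe H (ℕtoℚ (suc (suc d))) →
    (S : Subset n) →
    Overfull H (suc d) S →
    (∀ (T : Subset n) → Overfull H (suc d) T → slack H S (suc d) ℤ.≤ slack H T (suc d)) →
    (MaxDegLe (shrink H S) (suc d)
      × (3 ≤ suc (size (∁ S)) → GammaLe (shrink H S) (ℕtoℚ (suc (suc d))))
      × numDeg (shrink H S) (suc d) ≤ r)
    × (MaxDegLe (shrink H (∁ S)) (suc d)
      × (3 ≤ suc (size (∁ (∁ S))) → GammaLe (shrink H (∁ S)) (ℕtoℚ (suc (suc d))))
      × numDeg (shrink H (∁ S)) (suc d) ≤ r)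
mainTheorem6 d n r H _ Δ≤k #Δ≡r _ Γ≤k+1 S S-overfull S-minimal =
  conditions S (subst (_< k) (e⟨⟩-comm S (∁ S)) (cut<k Δ≤k)) outside ,
  conditions (∁ S) (subst (_< k) (sym (e⟨⟩-∁∁ˡ S (∁ S))) (cut<k Δ≤k)) inside
  where
  k : ℕ
  k = suc d
  open EdgeCount H
  open MinimalOverfull H k S S-overfull S-minimal
  conditions : ∀ X → e⟨ ∁ X , X ⟩ < k → Shrinking.BoundedWithNewVertex H X (suc k) →
    MaxDegLe (shrink H X) k
      × (3 ≤ suc (size (∁ X)) → GammaLe (shrink H X) (ℕtoℚ (suc k)))
      × numDeg (shrink H X) k ≤ r
  conditions X cut<k bounded =
    shrink-MaxDegLe Δ≤k (<⇒≤ cut<k) ,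
    (λ _ → shrink-GammaLe Γ≤k+1 bounded) ,
    ≤-trans (numDeg-shrink≤ cut<k) (≤-reflexive #Δ≡r)
    where open Shrinking H X
  outside : Shrinking.BoundedWithNewVertex H S (suc k)
  outside T h |T|≡ = outside-bound h (DisjointUnion-∁∁ʳ (spread∪∁≐spread⊎∁ (∁ S) T))
                                     (trans (size-spread (∁ S) T) |T|≡)
  inside : Shrinking.BoundedWithNewVertex H (∁ S) (suc k)
  inside T h |T|≡ = inside-bound Δ≤k h (DisjointUnion-∁∁ˡ (C≐spread⊎spread∁ (∁ (∁ S)) T))
                                     (trans (size-spread (∁ (∁ S)) T) |T|≡)
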